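{- Let $n\geqslant 1$ and $1\leqslant i\leqslant n$. If the set $S_{i,n}$ is Laplacian realizable, then the set $S_{\{i+1,n+2\}_{n+3}^{1}}$ is Laplacian realizable.
   Context: For a simple graph $G$, its Laplacian spectrum is the multiset of eigenvalues of $L(G)=D-A$ ($D$ the degree diagonal matrix, $A$ the adjacency matrix). For integers $1\leqslant i\leqslant n$, $S_{i,n}$ denotes the set $\{0,1,2,\ldots,n\}\setminus\{i\}$. For integers $0<i<j\leqslant n$ and $m\in\{1,\dots,n\}\setminus\{i,j\}$, $S_{\{i,j\}_{n}^{m}}$ denotes the multiset $\{0,1,\ldots,m-1,m,m,m+1,\ldots,n\}\setminus\{i,j\}$ (all integers $0,\dots,n$ each once, except $m$ appearing twice, with $i$ and $j$ removed; it has $n$ elements). A multiset $S$ is called Laplacian realizable if there is a simple connected graph whose Laplacian spectrum (with multiplicities) equals $S$; such a graph is said to realize $S$. -}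

module Defs where

open import Data.Nat as ℕ using (ℕ; zero; suc)
open import Data.Integer as ℤ using (ℤ; +_; -_; _*_; _+_; _-_)
open import Data.Fin using (Fin; zero; suc; toℕ; punchIn)
open import Data.Fin.Properties using () renaming (_≟_ to _≟F_)
open import Data.Bool using (Bool; true; false; if_then_else_)
open import Data.List as List using (List; []; _∷_; length; filter; map; upTo)
open import Data.Product using (Σ; _×_; _,_)
open import Relation.Binary.PropositionalEquality using (_≡_)
open import Relation.Nullary using (¬_; does)
open import Relation.Nullary.Decidable using (¬?; _×-dec_)

record SimpleGraph (n : ℕ) : Set where
  field
    adj     : Fin n → Fin n → Bool
    adj-sym : ∀ u v → adj u v ≡ adj v u
    irrefl  : ∀ u → adj u u ≡ false
open SimpleGraph public

data Reach {n : ℕ} (G : SimpleGraph n) : Fin n → Fin n → Set where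
  here : ∀ {u} → Reach G u u
  step : ∀ {u v w} → adj G u v ≡ true → Reach G v w → Reach G u w

Connected : ∀ {n} → SimpleGraph n → Set
Connected {n} G = ∀ (u v : Fin n) → Reach G u v

Matrix : ℕ → Set
Matrix n = Fin n → Fin n → ℤ

sumFin : ∀ n → (Fin n → ℤ) → ℤ
sumFin zero    f = + 0
sumFin (suc n) f = f zero + sumFin n (λ i → f (suc i))

sign : ℕ → ℤ
sign zero          = + 1
sign (suc zero)    = - (+ 1)
sign (suc (suc k)) = sign k

det : ∀ n → Matrix n → ℤ
det zero    M = + 1
det (suc n) M =
  sumFin (suc n) (λ j → sign (toℕ j) * (M zero j * det n (λ r c → M (suc r) (punchIn j c))))

b2z : Bool → ℤ
b2z true  = + 1
b2z false = + 0

degree : ∀ {n} → SimpleGraph n → Fin n → ℤ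
degree {n} G u = sumFin n (λ v → b2z (adj G u v))

laplacian : ∀ {n} → SimpleGraph n → Matrix n
laplacian G u v = if does (u ≟F v) then degree G u else - b2z (adj G u v)

charPolyAt : ∀ {n} → SimpleGraph n → ℤ → ℤ
charPolyAt {n} G x =
  det n (λ u v → (if does (u ≟F v) then x else + 0) - laplacian G u v)

prodRoots : List ℤ → ℤ → ℤ
prodRoots []      x = + 1
prodRoots (s ∷ S) x = (x - s) * prodRoots S x

-- The Laplacian spectrum of G (with multiplicities) equals the multiset S:
-- the characteristic polynomial of L(G) is ∏_{s∈S}(x - s)
-- (equality of integer polynomials, checked pointwise on all of ℤ).
LaplacianSpectrumIs : ∀ {n} → SimpleGraph n → List ℤ → Set
LaplacianSpectrumIs G S = ∀ (x : ℤ) → charPolyAt G x ≡ prodRoots S x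

LaplacianRealizable : List ℤ → Set
LaplacianRealizable S =
  Σ (SimpleGraph (length S)) λ G → Connected G × LaplacianSpectrumIs G S

range0 : ℕ → List ℕ
range0 n = upTo (suc n)

S-single : ℕ → ℕ → List ℤ
S-single i n = map +_ (filter (λ k → ¬? (k ℕ.≟ i)) (range0 n))

-- S_{{i,j}_n^m} = {0,...,m,m,...,n} \ {i,j}   (used with m ∉ {i,j})
S-pair : ℕ → ℕ → ℕ → ℕ → List ℤ
S-pair i j n m =
  + m ∷ map +_ (filter (λ k → ¬? (k ℕ.≟ i) ×-dec ¬? (k ℕ.≟ j)) (range0 n))

module Submission where

-- Let G realize S on n vertices and let H = K₁ ∨ (G ∪ 2K₁). With the vertices of H ordered
-- leaf, apex, leaf, G, the matrix xI − L(H) arises from (x − 1)I − L(G) by three borderings.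
-- Expanding along the first leaf, and clearing the apex column by subtracting all other columns
-- (the rows of the block beside it all sum to x − 1), gives
--   det(xI − L(H)) = x (x − 1) (x − (n + 3)) det((x − 1)I − L(G)).
-- So H is connected with spectrum {1, 0} ∪ (S + 1) ∪ {n + 3}, which for S = S_{i,n} is
-- S_{{i+1,n+2}_{n+3}^1}.

open import Defs
open import Data.Bool using (Bool; true; false; if_then_else_)
open import Data.Fin using (Fin; zero; suc; toℕ; punchIn)
open import Data.Fin.Properties using () renaming (_≟_ to _≟F_)
import Data.Integer as ℤ
open import Data.List using (List; []; _∷_; _++_; map; length; filter; upTo)
open import Data.List.Properties
  using (length-++; length-map; filter-++; filter-accept; filter-reject; filter-all; map-++; map-∘;
         ++-identityʳ; upTo-∷ʳ; map-upTo; length-upTo)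
open import Data.List.Relation.Unary.All as All using (All; []; _∷_)
open import Data.List.Membership.Propositional.Properties using (∈-upTo⁻)
open import Data.Nat as ℕ using (ℕ; zero; suc)
import Data.Nat.Properties as ℕ
open import Data.Product using (Σ; _×_; _,_)
open import Function using (_∘_)
open import Level using (0ℓ)
open import Relation.Binary.PropositionalEquality
open import Relation.Nullary using (does; yes; no)
open import Relation.Nullary.Decidable using (¬?; _×-dec_)
open import Relation.Unary using (Pred; Decidable)

private variable
  n : ℕ

Reach-trans : {G : SimpleGraph n} {u v w : Fin n} → Reach G u v → Reach G v w → Reach G u w
Reach-trans here        q = q
Reach-trans (step uv p) q = step uv (Reach-trans p q)

Reach-sym : {G : SimpleGraph n} {u v : Fin n} → Reach G u v → Reach G v u
Reach-sym         here        = here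
Reach-sym {G = G} (step uv p) = Reach-trans (Reach-sym p) (step (trans (adj-sym G _ _) uv) here)

connected-from : (G : SimpleGraph n) (a : Fin n) → (∀ u → Reach G a u) → Connected G
connected-from G a reach u v = Reach-trans (Reach-sym (reach u)) (reach v)

data Role (n : ℕ) : Set where
  apex leaf : Role n
  inner     : Fin n → Role n

role : Fin (3 ℕ.+ n) → Role n
role zero                = leaf
role (suc zero)          = apex
role (suc (suc zero))    = leaf
role (suc (suc (suc v))) = inner v

module _ (G : SimpleGraph n) where

  roleAdj : Role n → Role n → Bool
  roleAdj apex      apex      = false
  roleAdj apex      _         = true
  roleAdj _         apex      = true
  roleAdj (inner u) (inner v) = adj G u v
  roleAdj _         _         = false

  roleAdj-sym : ∀ p q → roleAdj p q ≡ roleAdj q p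
  roleAdj-sym apex      apex      = refl
  roleAdj-sym apex      leaf      = refl
  roleAdj-sym apex      (inner v) = refl
  roleAdj-sym leaf      apex      = refl
  roleAdj-sym leaf      leaf      = refl
  roleAdj-sym leaf      (inner v) = refl
  roleAdj-sym (inner u) apex      = refl
  roleAdj-sym (inner u) leaf      = refl
  roleAdj-sym (inner u) (inner v) = adj-sym G u v

  roleAdj-irrefl : ∀ p → roleAdj p p ≡ false
  roleAdj-irrefl apex      = refl
  roleAdj-irrefl leaf      = refl
  roleAdj-irrefl (inner v) = irrefl G v

  apexJoin : SimpleGraph (3 ℕ.+ n)
  apexJoin = record
    { adj     = λ u v → roleAdj (role u) (role v)
    ; adj-sym = λ u v → roleAdj-sym (role u) (role v)
    ; irrefl  = λ u → roleAdj-irrefl (role u)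
    }

  apexJoin-connected : Connected apexJoin
  apexJoin-connected = connected-from apexJoin (suc zero) λ where
    zero                → step refl here
    (suc zero)          → here
    (suc (suc zero))    → step refl here
    (suc (suc (suc v))) → step refl here

module Determinant where

  open import Data.Integer using (ℤ; +_; -_; _+_; _*_; _-_)
  import Data.Integer.Properties as ℤ
  open import Data.Integer.Tactic.RingSolver using (solve-∀)
  open ≡-Reasoning

  sumFin-cong : {f g : Fin n → ℤ} → (∀ j → f j ≡ g j) → sumFin n f ≡ sumFin n g
  sumFin-cong {zero}  f≗g = refl
  sumFin-cong {suc n} f≗g = cong₂ _+_ (f≗g zero) (sumFin-cong (f≗g ∘ suc))

  sumFin-0 : {f : Fin n → ℤ} → (∀ j → f j ≡ + 0) → sumFin n f ≡ + 0
  sumFin-0 {zero}  f≗0 = refl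
  sumFin-0 {suc n} f≗0 = cong₂ _+_ (f≗0 zero) (sumFin-0 (f≗0 ∘ suc))

  sumFin-*ˡ : ∀ a (f : Fin n → ℤ) → sumFin n (λ j → a * f j) ≡ a * sumFin n f
  sumFin-*ˡ {zero}  a f = sym (ℤ.*-zeroʳ a)
  sumFin-*ˡ {suc n} a f = begin
    a * f zero + sumFin n (λ j → a * f (suc j)) ≡⟨ cong (_+_ (a * f zero)) (sumFin-*ˡ a (f ∘ suc)) ⟩
    a * f zero + a * sumFin n (f ∘ suc)         ≡⟨ ℤ.*-distribˡ-+ a (f zero) _ ⟨
    a * sumFin (suc n) f                        ∎

  sumFin-+ : ∀ (f g : Fin n → ℤ) → sumFin n (λ j → f j + g j) ≡ sumFin n f + sumFin n g
  sumFin-+ {zero}  f g = refl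
  sumFin-+ {suc n} f g = begin
    (f zero + g zero) + sumFin n (λ j → f (suc j) + g (suc j))
      ≡⟨ cong (_+_ (f zero + g zero)) (sumFin-+ (f ∘ suc) (g ∘ suc)) ⟩
    (f zero + g zero) + (sumFin n (f ∘ suc) + sumFin n (g ∘ suc))
      ≡⟨ interchange (f zero) (g zero) _ _ ⟩
    sumFin (suc n) f + sumFin (suc n) g ∎
    where
    interchange : ∀ a b c d → (a + b) + (c + d) ≡ (a + c) + (b + d)
    interchange = solve-∀

  sumFin-punchIn : ∀ (k : Fin (suc n)) (f : Fin (suc n) → ℤ) →
                   sumFin (suc n) f ≡ f k + sumFin n (f ∘ punchIn k)
  sumFin-punchIn         zero    f = refl
  sumFin-punchIn {suc n} (suc k) f = begin
    f zero + sumFin (suc n) (f ∘ suc)                     ≡⟨ cong (_+_ (f zero)) (sumFin-punchIn k (f ∘ suc)) ⟩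
    f zero + (f (suc k) + sumFin n (f ∘ suc ∘ punchIn k)) ≡⟨ swap (f zero) (f (suc k)) _ ⟩
    f (suc k) + sumFin (suc n) (f ∘ punchIn (suc k))      ∎
    where
    swap : ∀ a b c → a + (b + c) ≡ b + (a + c)
    swap = solve-∀

  sumFin-1 : ∀ n → sumFin n (λ _ → + 1) ≡ + n
  sumFin-1 zero    = refl
  sumFin-1 (suc n) = cong (_+_ (+ 1)) (sumFin-1 n)

  sumFin-indicator : ∀ (v : Fin n) a → sumFin n (λ u → if does (v ≟F u) then a else + 0) ≡ a
  sumFin-indicator {suc n} zero    a = trans (cong (_+_ a) (sumFin-0 {n} λ _ → refl)) (ℤ.+-identityʳ a)
  sumFin-indicator {suc n} (suc v) a = trans (ℤ.+-identityˡ _) (sumFin-indicator v a)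

  sign-suc : ∀ k → sign (suc k) ≡ - sign k
  sign-suc zero          = refl
  sign-suc (suc zero)    = refl
  sign-suc (suc (suc k)) = sign-suc k

  sign*sign≡1 : ∀ k → sign k * sign k ≡ + 1
  sign*sign≡1 zero          = refl
  sign*sign≡1 (suc zero)    = refl
  sign*sign≡1 (suc (suc k)) = sign*sign≡1 k

  private
    *-zeroʳ-nested : ∀ s a → s * (a * + 0) ≡ + 0
    *-zeroʳ-nested = solve-∀

  minor : Matrix (suc n) → Fin (suc n) → Matrix n
  minor M j r c = M (suc r) (punchIn j c)

  laplaceTerm : Matrix (suc n) → Fin (suc n) → ℤ
  laplaceTerm {n} M j = sign (toℕ j) * (M zero j * det n (minor M j))

  det-cong : ∀ n {M N : Matrix n} → (∀ r c → M r c ≡ N r c) → det n M ≡ det n N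
  det-cong zero    M≗N = refl
  det-cong (suc n) M≗N = sumFin-cong λ j →
    cong₂ (λ a d → sign (toℕ j) * (a * d)) (M≗N zero j) (det-cong n λ r c → M≗N (suc r) (punchIn j c))

  det-zeroCol : ∀ n (M : Matrix (suc n)) → (∀ r → M r zero ≡ + 0) → det (suc n) M ≡ + 0
  det-zeroCol n M col≡0 = sumFin-0 (term≡0 n M col≡0)
    where
    term≡0 : ∀ n (M : Matrix (suc n)) → (∀ r → M r zero ≡ + 0) → ∀ j → laplaceTerm M j ≡ + 0
    term≡0 n       M col≡0 zero    rewrite col≡0 zero = ℤ.*-zeroʳ (+ 1)
    term≡0 (suc n) M col≡0 (suc j) =
      trans (cong (λ d → sign (toℕ (suc j)) * (M zero (suc j) * d))
                  (det-zeroCol n (minor M (suc j)) (col≡0 ∘ suc)))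
            (*-zeroʳ-nested (sign (toℕ (suc j))) (M zero (suc j)))

  border : ℤ → (Fin n → ℤ) → (Fin n → ℤ) → Matrix n → Matrix (suc n)
  border a row col B zero    zero    = a
  border a row col B zero    (suc c) = row c
  border a row col B (suc r) zero    = col r
  border a row col B (suc r) (suc c) = B r c

  0s 1s : Fin n → ℤ
  0s _ = + 0
  1s _ = + 1

  e₀ : Fin (suc n) → ℤ
  e₀ zero    = + 1
  e₀ (suc _) = + 0

  det-border-0s : ∀ n a (row : Fin n → ℤ) (B : Matrix n) → det (suc n) (border a row 0s B) ≡ a * det n B
  det-border-0s n a row B = begin
    + 1 * (a * det n B) + sumFin n (laplaceTerm (border a row 0s B) ∘ suc)
      ≡⟨ cong (_+_ (+ 1 * (a * det n B))) (sumFin-0 (term≡0 n row B)) ⟩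
    + 1 * (a * det n B) + + 0
      ≡⟨ simplify a (det n B) ⟩
    a * det n B ∎
    where
    simplify : ∀ a d → + 1 * (a * d) + + 0 ≡ a * d
    simplify = solve-∀
    term≡0 : ∀ n (row : Fin n → ℤ) (B : Matrix n) j → laplaceTerm (border a row 0s B) (suc j) ≡ + 0
    term≡0 (suc n) row B j =
      trans (cong (λ d → sign (toℕ (suc j)) * (row j * d))
                  (det-zeroCol n (minor (border a row 0s B) (suc j)) λ _ → refl))
            (*-zeroʳ-nested (sign (toℕ (suc j))) (row j))

  -- relocate k j is the index of column k in the minor that deletes column punchIn k j.
  relocate : Fin (suc n) → Fin n → Fin n
  relocate zero    zero    = zero
  relocate zero    (suc j) = zero
  relocate (suc k) zero    = k
  relocate (suc k) (suc j) = suc (relocate k j)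

  punchIn-relocate : ∀ (k : Fin (suc n)) j → punchIn (punchIn k j) (relocate k j) ≡ k
  punchIn-relocate zero    zero    = refl
  punchIn-relocate zero    (suc j) = refl
  punchIn-relocate (suc k) zero    = refl
  punchIn-relocate (suc k) (suc j) = cong suc (punchIn-relocate k j)

  punchIn-punchIn-relocate : ∀ (k : Fin (suc (suc n))) j c →
                             punchIn (punchIn k j) (punchIn (relocate k j) c) ≡ punchIn k (punchIn j c)
  punchIn-punchIn-relocate zero    zero    c       = refl
  punchIn-punchIn-relocate zero    (suc j) c       = refl
  punchIn-punchIn-relocate (suc k) zero    c       = refl
  punchIn-punchIn-relocate (suc k) (suc j) zero    = refl
  punchIn-punchIn-relocate (suc k) (suc j) (suc c) = cong suc (punchIn-punchIn-relocate k j c)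

  sign-relocate : ∀ (k : Fin (suc n)) j →
                  sign (suc (toℕ j)) * sign (toℕ (relocate k j)) ≡ sign (toℕ k) * sign (toℕ (punchIn k j))
  sign-relocate zero    zero    = refl
  sign-relocate zero    (suc j) = ℤ.*-comm (sign (toℕ j)) (+ 1)
  sign-relocate (suc k) zero    = begin
    - (+ 1) * sign (toℕ k)      ≡⟨ neg-*-comm (sign (toℕ k)) ⟩
    - sign (toℕ k) * + 1        ≡⟨ cong (_* + 1) (sign-suc (toℕ k)) ⟨
    sign (suc (toℕ k)) * sign 0 ∎
    where
    neg-*-comm : ∀ a → - (+ 1) * a ≡ - a * + 1
    neg-*-comm = solve-∀
  sign-relocate (suc k) (suc j) = begin
    sign (toℕ j) * sign (suc r)       ≡⟨ cong (sign (toℕ j) *_) (sign-suc r) ⟩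
    sign (toℕ j) * - sign r           ≡⟨ neg-move (sign (toℕ j)) (sign r) ⟩
    - sign (toℕ j) * sign r           ≡⟨ cong (_* sign r) (sign-suc (toℕ j)) ⟨
    sign (suc (toℕ j)) * sign r       ≡⟨ sign-relocate k j ⟩
    sign (toℕ k) * sign p             ≡⟨ neg-neg (sign (toℕ k)) (sign p) ⟩
    - sign (toℕ k) * - sign p         ≡⟨ cong₂ _*_ (sign-suc (toℕ k)) (sign-suc p) ⟨
    sign (suc (toℕ k)) * sign (suc p) ∎
    where
    r = toℕ (relocate k j)
    p = toℕ (punchIn k j)
    neg-move : ∀ a b → a * - b ≡ - a * b
    neg-move = solve-∀
    neg-neg : ∀ a b → a * b ≡ - a * - b
    neg-neg = solve-∀

  rotateCol : Fin (suc n) → Matrix (suc n) → Matrix (suc n)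
  rotateCol k M r zero    = M r k
  rotateCol k M r (suc c) = M r (punchIn k c)

  minor-rotateCol : ∀ (k : Fin (suc (suc n))) j (M : Matrix (suc (suc n))) r c →
                    minor (rotateCol k M) (suc j) r c ≡ rotateCol (relocate k j) (minor M (punchIn k j)) r c
  minor-rotateCol k j M r zero    = cong (M (suc r)) (sym (punchIn-relocate k j))
  minor-rotateCol k j M r (suc c) = cong (M (suc r)) (sym (punchIn-punchIn-relocate k j c))

  det-rotateCol : ∀ n k (M : Matrix (suc n)) → det (suc n) (rotateCol k M) ≡ sign (toℕ k) * det (suc n) M
  det-rotateCol zero    zero M = sym (ℤ.*-identityˡ _)
  det-rotateCol (suc n) k    M = begin
    + 1 * X + sumFin (suc n) (laplaceTerm (rotateCol k M) ∘ suc)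
      ≡⟨ cong (_+_ (+ 1 * X)) (sumFin-cong moved-term) ⟩
    + 1 * X + sumFin (suc n) (λ j → s * F (punchIn k j))
      ≡⟨ cong (_+_ (+ 1 * X)) (sumFin-*ˡ s (F ∘ punchIn k)) ⟩
    + 1 * X + s * sumFin (suc n) (F ∘ punchIn k)
      ≡⟨ factor-sign s X _ (sign*sign≡1 (toℕ k)) ⟩
    s * (F k + sumFin (suc n) (F ∘ punchIn k))
      ≡⟨ cong (s *_) (sumFin-punchIn k F) ⟨
    s * det (suc (suc n)) M ∎
    where
    s = sign (toℕ k)
    X = M zero k * det (suc n) (minor M k)
    F = laplaceTerm M
    factor-sign : ∀ s X S → s * s ≡ + 1 → + 1 * X + s * S ≡ s * (s * X + S)
    factor-sign s X S s²≡1 = trans (cong (λ t → t * X + s * S) (sym s²≡1)) (ring s X S)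
      where
      ring : ∀ s X S → (s * s) * X + s * S ≡ s * (s * X + S)
      ring = solve-∀
    reassociate : ∀ s r k p a d → s * r ≡ k * p → s * (a * (r * d)) ≡ k * (p * (a * d))
    reassociate s r k p a d sr≡kp = trans (ring₁ s r a d) (trans (cong (_* (a * d)) sr≡kp) (ring₂ k p a d))
      where
      ring₁ : ∀ s r a d → s * (a * (r * d)) ≡ (s * r) * (a * d)
      ring₁ = solve-∀
      ring₂ : ∀ k p a d → (k * p) * (a * d) ≡ k * (p * (a * d))
      ring₂ = solve-∀
    moved-term : ∀ j → laplaceTerm (rotateCol k M) (suc j) ≡ s * F (punchIn k j)
    moved-term j = begin
      sign (suc (toℕ j)) * (e * det (suc n) (minor (rotateCol k M) (suc j)))
        ≡⟨ cong (λ d → sign (suc (toℕ j)) * (e * d)) (trans (det-cong (suc n) (minor-rotateCol k j M))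
                                                             (det-rotateCol n (relocate k j) M′)) ⟩
      sign (suc (toℕ j)) * (e * (sign (toℕ (relocate k j)) * det (suc n) M′))
        ≡⟨ reassociate (sign (suc (toℕ j))) (sign (toℕ (relocate k j))) s (sign (toℕ (punchIn k j)))
                       e (det (suc n) M′) (sign-relocate k j) ⟩
      s * F (punchIn k j) ∎
      where
      e  = M zero (punchIn k j)
      M′ = minor M (punchIn k j)

  det-equalCols : ∀ n (M : Matrix (suc n)) k → (∀ r → M r zero ≡ M r (suc k)) → det (suc n) M ≡ + 0
  det-equalCols (suc n) M k same = begin
    F zero + sumFin (suc n) (F ∘ suc)
      ≡⟨ cong (_+_ (F zero)) (sumFin-punchIn k (F ∘ suc)) ⟩
    F zero + (F (suc k) + sumFin n (F ∘ suc ∘ punchIn k))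
      ≡⟨ cong (λ t → F zero + (F (suc k) + t)) (sumFin-0 other-term≡0) ⟩
    F zero + (F (suc k) + + 0)
      ≡⟨ cong (λ t → F zero + (t + + 0)) rotated-term ⟩
    + 1 * (a * d) + (- s * (a * (s * d)) + + 0)
      ≡⟨ cancel s a d (sign*sign≡1 (toℕ k)) ⟩
    + 0 ∎
    where
    F = laplaceTerm M
    a = M zero zero
    d = det (suc n) (minor M zero)
    s = sign (toℕ k)
    minor-suc-k : ∀ r c → minor M (suc k) r c ≡ rotateCol k (minor M zero) r c
    minor-suc-k r zero    = same (suc r)
    minor-suc-k r (suc c) = refl
    rotated-term : F (suc k) ≡ - s * (a * (s * d))
    rotated-term = begin
      sign (suc (toℕ k)) * (M zero (suc k) * det (suc n) (minor M (suc k)))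
        ≡⟨ cong₂ (λ t u → t * (u * det (suc n) (minor M (suc k)))) (sign-suc (toℕ k)) (sym (same zero)) ⟩
      - s * (a * det (suc n) (minor M (suc k)))
        ≡⟨ cong (λ t → - s * (a * t)) (trans (det-cong (suc n) minor-suc-k) (det-rotateCol n k (minor M zero))) ⟩
      - s * (a * (s * d)) ∎
    other-term≡0 : ∀ i → F (suc (punchIn k i)) ≡ + 0
    other-term≡0 i = trans (cong (λ t → sign (toℕ (suc p)) * (M zero (suc p) * t))
                                 (det-equalCols n (minor M (suc p)) (relocate k i) same-in-minor))
                           (*-zeroʳ-nested (sign (toℕ (suc p))) (M zero (suc p)))
      where
      p = punchIn k i
      same-in-minor : ∀ r → M (suc r) zero ≡ M (suc r) (suc (punchIn p (relocate k i)))
      same-in-minor r = trans (same (suc r)) (cong (λ c → M (suc r) (suc c)) (sym (punchIn-relocate k i)))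
    cancel : ∀ s a d → s * s ≡ + 1 → + 1 * (a * d) + (- s * (a * (s * d)) + + 0) ≡ + 0
    cancel s a d s²≡1 = trans (ring s a d) (trans (cong (λ t → a * d - t * (a * d)) s²≡1) (ring′ a d))
      where
      ring : ∀ s a d → + 1 * (a * d) + (- s * (a * (s * d)) + + 0) ≡ a * d - (s * s) * (a * d)
      ring = solve-∀
      ring′ : ∀ a d → a * d - + 1 * (a * d) ≡ + 0
      ring′ = solve-∀

  setCol₀ : Matrix (suc n) → (Fin (suc n) → ℤ) → Matrix (suc n)
  setCol₀ M w r zero    = w r
  setCol₀ M w r (suc c) = M r (suc c)

  det-setCol₀-cong : ∀ n (M : Matrix (suc n)) u v → (∀ r → u r ≡ v r) →
                     det (suc n) (setCol₀ M u) ≡ det (suc n) (setCol₀ M v)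
  det-setCol₀-cong n M u v u≗v = det-cong (suc n) {setCol₀ M u} {setCol₀ M v} λ where
    r zero    → u≗v r
    r (suc c) → refl

  minor-setCol₀ : ∀ (M : Matrix (suc (suc n))) w j r c →
                  minor (setCol₀ M w) (suc j) r c ≡ setCol₀ (minor M (suc j)) (w ∘ suc) r c
  minor-setCol₀ M w j r zero    = refl
  minor-setCol₀ M w j r (suc c) = refl

  det-setCol₀-linear : ∀ n (M : Matrix (suc n)) a b (u v : Fin (suc n) → ℤ) →
                       det (suc n) (setCol₀ M (λ r → a * u r + b * v r))
                       ≡ a * det (suc n) (setCol₀ M u) + b * det (suc n) (setCol₀ M v)
  det-setCol₀-linear zero    M a b u v = ring a b (u zero) (v zero)
    where
    ring : ∀ a b x y → + 1 * ((a * x + b * y) * + 1) + + 0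
                       ≡ a * (+ 1 * (x * + 1) + + 0) + b * (+ 1 * (y * + 1) + + 0)
    ring = solve-∀
  det-setCol₀-linear (suc n) M a b u v = begin
    + 1 * ((a * u zero + b * v zero) * d) + sumFin (suc n) (term w)
      ≡⟨ cong (_+_ (+ 1 * ((a * u zero + b * v zero) * d))) tail-linear ⟩
    + 1 * ((a * u zero + b * v zero) * d) + (a * sumFin (suc n) (term u) + b * sumFin (suc n) (term v))
      ≡⟨ ring a b (u zero) (v zero) d _ _ ⟩
    a * det (suc (suc n)) (setCol₀ M u) + b * det (suc (suc n)) (setCol₀ M v) ∎
    where
    w = λ r → a * u r + b * v r
    d = det (suc n) (minor M zero)
    term : (Fin (suc (suc n)) → ℤ) → Fin (suc n) → ℤ
    term x = laplaceTerm (setCol₀ M x) ∘ suc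
    det-minor : ∀ x j → det (suc n) (minor (setCol₀ M x) (suc j))
                        ≡ det (suc n) (setCol₀ (minor M (suc j)) (x ∘ suc))
    det-minor x j = det-cong (suc n) (minor-setCol₀ M x j)
    term-linear : ∀ j → term w j ≡ a * term u j + b * term v j
    term-linear j = begin
      s * (e * det (suc n) (minor (setCol₀ M w) (suc j)))
        ≡⟨ cong (λ t → s * (e * t)) (trans (det-minor w j) (det-setCol₀-linear n M′ a b (u ∘ suc) (v ∘ suc))) ⟩
      s * (e * (a * det (suc n) (setCol₀ M′ (u ∘ suc)) + b * det (suc n) (setCol₀ M′ (v ∘ suc))))
        ≡⟨ cong₂ (λ p q → s * (e * (a * p + b * q))) (det-minor u j) (det-minor v j) ⟨
      s * (e * (a * det (suc n) (minor (setCol₀ M u) (suc j)) + b * det (suc n) (minor (setCol₀ M v) (suc j))))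
        ≡⟨ distribute s e a b _ _ ⟩
      a * term u j + b * term v j ∎
      where
      s  = sign (suc (toℕ j))
      e  = M zero (suc j)
      M′ = minor M (suc j)
      distribute : ∀ s x a b p q → s * (x * (a * p + b * q)) ≡ a * (s * (x * p)) + b * (s * (x * q))
      distribute = solve-∀
    tail-linear : sumFin (suc n) (term w) ≡ a * sumFin (suc n) (term u) + b * sumFin (suc n) (term v)
    tail-linear = begin
      sumFin (suc n) (term w)
        ≡⟨ sumFin-cong term-linear ⟩
      sumFin (suc n) (λ j → a * term u j + b * term v j)
        ≡⟨ sumFin-+ (λ j → a * term u j) (λ j → b * term v j) ⟩
      sumFin (suc n) (λ j → a * term u j) + sumFin (suc n) (λ j → b * term v j)
        ≡⟨ cong₂ _+_ (sumFin-*ˡ a (term u)) (sumFin-*ˡ b (term v)) ⟩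
      a * sumFin (suc n) (term u) + b * sumFin (suc n) (term v) ∎
    ring : ∀ a b x y d U V → + 1 * ((a * x + b * y) * d) + (a * U + b * V)
                             ≡ a * (+ 1 * (x * d) + U) + b * (+ 1 * (y * d) + V)
    ring = solve-∀

  det-setCol₀-sumFin : ∀ n (M : Matrix (suc n)) m (F : Fin m → Fin (suc n) → ℤ) →
                       det (suc n) (setCol₀ M (λ r → sumFin m (λ k → F k r)))
                       ≡ sumFin m (λ k → det (suc n) (setCol₀ M (F k)))
  det-setCol₀-sumFin n M zero    F = det-zeroCol n (setCol₀ M 0s) λ _ → refl
  det-setCol₀-sumFin n M (suc m) F = begin
    det (suc n) (setCol₀ M (λ r → F zero r + rest r))
      ≡⟨ det-setCol₀-cong n M _ _ (λ r → unit-weights (F zero r) (rest r)) ⟨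
    det (suc n) (setCol₀ M (λ r → + 1 * F zero r + + 1 * rest r))
      ≡⟨ det-setCol₀-linear n M (+ 1) (+ 1) (F zero) rest ⟩
    + 1 * D₀ + + 1 * det (suc n) (setCol₀ M rest)
      ≡⟨ cong (λ t → + 1 * D₀ + + 1 * t) (det-setCol₀-sumFin n M m (F ∘ suc)) ⟩
    + 1 * D₀ + + 1 * sumFin m (λ k → det (suc n) (setCol₀ M (F (suc k))))
      ≡⟨ unit-weights D₀ (sumFin m (λ k → det (suc n) (setCol₀ M (F (suc k))))) ⟩
    sumFin (suc m) (λ k → det (suc n) (setCol₀ M (F k))) ∎
    where
    rest = λ r → sumFin m (λ k → F (suc k) r)
    D₀ = det (suc n) (setCol₀ M (F zero))
    unit-weights : ∀ x y → + 1 * x + + 1 * y ≡ x + y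
    unit-weights = solve-∀

  -- Replacing column 0 by y·(column 0) − (sum of the other columns) multiplies the determinant
  -- by y and, since the rows of B sum to y, leaves only the corner y c − m in that column.
  det-bordered : ∀ m y c (B : Matrix m) → (∀ r → sumFin m (B r) ≡ y) →
                 y * det (suc m) (border c 1s 1s B) ≡ (y * c - + m) * det m B
  det-bordered m y c B rowSum≡y = begin
    y * det (suc m) N                          ≡⟨ det-combined ⟨
    det (suc m) (setCol₀ N combination)        ≡⟨ det-cong (suc m) combination-cleared ⟩
    det (suc m) (border (y * c - + m) 1s 0s B) ≡⟨ det-border-0s m (y * c - + m) 1s B ⟩
    (y * c - + m) * det m B                    ∎
    where
    N = border c 1s 1s B
    otherCols = λ r → sumFin m (λ k → N r (suc k))
    combination = λ r → y * N r zero + - (+ 1) * otherCols r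
    det-otherCols≡0 : det (suc m) (setCol₀ N otherCols) ≡ + 0
    det-otherCols≡0 = trans (det-setCol₀-sumFin m N m (λ k r → N r (suc k)))
                            (sumFin-0 λ k → det-equalCols m (setCol₀ N (λ r → N r (suc k))) k λ _ → refl)
    setCol₀-own : ∀ r c → setCol₀ N (λ r → N r zero) r c ≡ N r c
    setCol₀-own r zero    = refl
    setCol₀-own r (suc c) = refl
    det-combined : det (suc m) (setCol₀ N combination) ≡ y * det (suc m) N
    det-combined = begin
      det (suc m) (setCol₀ N combination)
        ≡⟨ det-setCol₀-linear m N y (- (+ 1)) (λ r → N r zero) otherCols ⟩
      y * det (suc m) (setCol₀ N (λ r → N r zero)) + - (+ 1) * det (suc m) (setCol₀ N otherCols)
        ≡⟨ cong₂ (λ p q → y * p + - (+ 1) * q) (det-cong (suc m) setCol₀-own) det-otherCols≡0 ⟩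
      y * det (suc m) N + - (+ 1) * + 0
        ≡⟨ drop-zero y (det (suc m) N) ⟩
      y * det (suc m) N ∎
      where
      drop-zero : ∀ y d → y * d + - (+ 1) * + 0 ≡ y * d
      drop-zero = solve-∀
    combination-cleared : ∀ r j → setCol₀ N combination r j ≡ border (y * c - + m) 1s 0s B r j
    combination-cleared zero    zero    = trans (cong (λ t → y * c + - (+ 1) * t) (sumFin-1 m)) (ring y c (+ m))
      where
      ring : ∀ y c m → y * c + - (+ 1) * m ≡ y * c - m
      ring = solve-∀
    combination-cleared (suc r) zero    = trans (cong (λ t → y * + 1 + - (+ 1) * t) (rowSum≡y r)) (ring y)
      where
      ring : ∀ y → y * + 1 + - (+ 1) * y ≡ + 0
      ring = solve-∀
    combination-cleared zero    (suc j) = refl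
    combination-cleared (suc r) (suc j) = refl

  det-pendant : ∀ n y (N : Matrix (suc n)) →
                det (suc (suc n)) (border y e₀ e₀ N) ≡ y * det (suc n) N - det n (minor N zero)
  det-pendant n y N = begin
    + 1 * (y * det (suc n) N) + (- (+ 1) * (+ 1 * det (suc n) (minor P (suc zero))) + sumFin n tail)
      ≡⟨ cong₂ (λ t u → + 1 * (y * det (suc n) N) + (- (+ 1) * (+ 1 * t) + u)) det-minor₁ (sumFin-0 tail≡0) ⟩
    + 1 * (y * det (suc n) N) + (- (+ 1) * (+ 1 * (+ 1 * det n (minor N zero))) + + 0)
      ≡⟨ ring y (det (suc n) N) (det n (minor N zero)) ⟩
    y * det (suc n) N - det n (minor N zero) ∎
    where
    P = border y e₀ e₀ N
    tail : Fin n → ℤ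
    tail j = laplaceTerm P (suc (suc j))
    tail≡0 : ∀ j → tail j ≡ + 0
    tail≡0 j = ℤ.*-zeroʳ (sign (toℕ j))
    minor₁ : ∀ r c → minor P (suc zero) r c ≡ border (+ 1) (λ c → N zero (suc c)) 0s (minor N zero) r c
    minor₁ zero    zero    = refl
    minor₁ zero    (suc c) = refl
    minor₁ (suc r) zero    = refl
    minor₁ (suc r) (suc c) = refl
    det-minor₁ : det (suc n) (minor P (suc zero)) ≡ + 1 * det n (minor N zero)
    det-minor₁ = trans (det-cong (suc n) minor₁) (det-border-0s n (+ 1) (λ c → N zero (suc c)) (minor N zero))
    ring : ∀ y d d′ → + 1 * (y * d) + (- (+ 1) * (+ 1 * (+ 1 * d′)) + + 0) ≡ y * d - d′
    ring = solve-∀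

module LaplacianSpectrum where

  open import Data.Integer using (ℤ; +_; -_; _+_; _*_; _-_)
  import Data.Integer.Properties as ℤ
  open import Data.Integer.Tactic.RingSolver using (solve-∀)
  open Determinant
  open ≡-Reasoning

  charMatrix : SimpleGraph n → ℤ → Matrix n
  charMatrix G x u v = (if does (u ≟F v) then x else + 0) - laplacian G u v

  charMatrix-entry : ∀ (G : SimpleGraph n) x u v →
                     charMatrix G x u v ≡ (if does (u ≟F v) then x - degree G u else + 0) + b2z (adj G u v)
  charMatrix-entry G x u v with u ≟F v
  ... | yes refl rewrite irrefl G u = sym (ℤ.+-identityʳ (x - degree G u))
  ... | no  _    = ring (b2z (adj G u v))
    where
    ring : ∀ b → + 0 - - b ≡ + 0 + b
    ring = solve-∀

  charMatrix-rowSum : ∀ (G : SimpleGraph n) x u → sumFin n (charMatrix G x u) ≡ x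
  charMatrix-rowSum {n} G x u = begin
    sumFin n (charMatrix G x u)
      ≡⟨ sumFin-cong (charMatrix-entry G x u) ⟩
    sumFin n (λ v → (if does (u ≟F v) then x - degree G u else + 0) + b2z (adj G u v))
      ≡⟨ sumFin-+ _ (λ v → b2z (adj G u v)) ⟩
    sumFin n (λ v → if does (u ≟F v) then x - degree G u else + 0) + degree G u
      ≡⟨ cong (_+ degree G u) (sumFin-indicator u (x - degree G u)) ⟩
    x - degree G u + degree G u
      ≡⟨ ring x (degree G u) ⟩
    x ∎
    where
    ring : ∀ x d → x - d + d ≡ x
    ring = solve-∀

  module _ (G : SimpleGraph n) (x : ℤ) where

    private
      H = apexJoin G
      y = x - + 1

    degree-apexJoin-leaf : degree H zero ≡ + 1
    degree-apexJoin-leaf = cong (λ t → + 0 + (+ 1 + (+ 0 + t))) (sumFin-0 {n} λ _ → refl)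

    degree-apexJoin-apex : degree H (suc zero) ≡ + (2 ℕ.+ n)
    degree-apexJoin-apex = cong (λ t → + 1 + (+ 0 + (+ 1 + t))) (sumFin-1 n)

    apexJoinMatrix : Matrix (3 ℕ.+ n)
    apexJoinMatrix = border y e₀ e₀ (border (x - + (2 ℕ.+ n)) 1s 1s (border y 0s 0s (charMatrix G y)))

    charMatrix-apexJoin : ∀ r c → charMatrix H x r c ≡ apexJoinMatrix r c
    charMatrix-apexJoin zero                zero                = cong (_-_ x) degree-apexJoin-leaf
    charMatrix-apexJoin zero                (suc zero)          = refl
    charMatrix-apexJoin zero                (suc (suc zero))    = refl
    charMatrix-apexJoin zero                (suc (suc (suc c))) = refl
    charMatrix-apexJoin (suc zero)          zero                = refl
    charMatrix-apexJoin (suc zero)          (suc zero)          = cong (_-_ x) degree-apexJoin-apex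
    charMatrix-apexJoin (suc zero)          (suc (suc zero))    = refl
    charMatrix-apexJoin (suc zero)          (suc (suc (suc c))) = refl
    charMatrix-apexJoin (suc (suc zero))    zero                = refl
    charMatrix-apexJoin (suc (suc zero))    (suc zero)          = refl
    charMatrix-apexJoin (suc (suc zero))    (suc (suc zero))    = cong (_-_ x) degree-apexJoin-leaf
    charMatrix-apexJoin (suc (suc zero))    (suc (suc (suc c))) = refl
    charMatrix-apexJoin (suc (suc (suc r))) zero                = refl
    charMatrix-apexJoin (suc (suc (suc r))) (suc zero)          = refl
    charMatrix-apexJoin (suc (suc (suc r))) (suc (suc zero))    = refl
    charMatrix-apexJoin (suc (suc (suc r))) (suc (suc (suc c))) with r ≟F c
    ... | yes _ = ring x (degree G r)
      where
      ring : ∀ x d → x - (+ 0 + (+ 1 + (+ 0 + d))) ≡ x - + 1 - d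
      ring = solve-∀
    ... | no  _ = refl

    charPoly-apexJoin : charPolyAt H x ≡ x * (y * ((x - + (3 ℕ.+ n)) * charPolyAt G y))
    charPoly-apexJoin = begin
      det (3 ℕ.+ n) (charMatrix H x)
        ≡⟨ det-cong (3 ℕ.+ n) charMatrix-apexJoin ⟩
      det (3 ℕ.+ n) (border y e₀ e₀ N)
        ≡⟨ det-pendant (suc n) y N ⟩
      y * det (2 ℕ.+ n) N - det (suc n) E
        ≡⟨ cong (_- det (suc n) E) (det-bordered (suc n) y c E E-rowSum) ⟩
      (y * c - + (suc n)) * det (suc n) E - det (suc n) E
        ≡⟨ cong (λ t → (y * c - + (suc n)) * t - t) (det-border-0s n y 0s (charMatrix G y)) ⟩
      (y * c - + (suc n)) * (y * D) - y * D
        ≡⟨ ring x (+ n) D ⟩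
      x * (y * ((x - + (3 ℕ.+ n)) * D)) ∎
      where
      c = x - + (2 ℕ.+ n)
      E = border y 0s 0s (charMatrix G y)
      N = border c 1s 1s E
      D = charPolyAt G y
      E-rowSum : ∀ r → sumFin (suc n) (E r) ≡ y
      E-rowSum zero    = trans (cong (_+_ y) (sumFin-0 {n} λ _ → refl)) (ℤ.+-identityʳ y)
      E-rowSum (suc v) = trans (ℤ.+-identityˡ _) (charMatrix-rowSum G y v)
      ring : ∀ x m D → ((x - + 1) * (x - (+ 2 + m)) - (+ 1 + m)) * ((x - + 1) * D) - (x - + 1) * D
                       ≡ x * ((x - + 1) * ((x - (+ 3 + m)) * D))
      ring = solve-∀

  prodRoots-++ : ∀ xs ys x → prodRoots (xs ++ ys) x ≡ prodRoots xs x * prodRoots ys x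
  prodRoots-++ []       ys x = sym (ℤ.*-identityˡ (prodRoots ys x))
  prodRoots-++ (s ∷ xs) ys x = begin
    (x - s) * prodRoots (xs ++ ys) x              ≡⟨ cong ((x - s) *_) (prodRoots-++ xs ys x) ⟩
    (x - s) * (prodRoots xs x * prodRoots ys x)   ≡⟨ ℤ.*-assoc (x - s) _ _ ⟨
    (x - s) * prodRoots xs x * prodRoots ys x     ∎

  prodRoots-suc : ∀ S x → prodRoots (map ℤ.suc S) x ≡ prodRoots S (x - + 1)
  prodRoots-suc []      x = refl
  prodRoots-suc (s ∷ S) x = cong₂ _*_ (ring x s) (prodRoots-suc S x)
    where
    ring : ∀ x s → x - (+ 1 + s) ≡ x - + 1 - s
    ring = solve-∀

  apexJoinSpectrum : List ℤ → List ℤ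
  apexJoinSpectrum S = + 1 ∷ + 0 ∷ map ℤ.suc S ++ + (3 ℕ.+ length S) ∷ []

  prodRoots-apexJoinSpectrum : ∀ S x →
    prodRoots (apexJoinSpectrum S) x ≡ x * ((x - + 1) * ((x - + (3 ℕ.+ length S)) * prodRoots S (x - + 1)))
  prodRoots-apexJoinSpectrum S x = begin
    (x - + 1) * ((x - + 0) * prodRoots (map ℤ.suc S ++ top ∷ []) x)
      ≡⟨ cong (λ t → (x - + 1) * ((x - + 0) * t)) (prodRoots-++ (map ℤ.suc S) (top ∷ []) x) ⟩
    (x - + 1) * ((x - + 0) * (prodRoots (map ℤ.suc S) x * ((x - top) * + 1)))
      ≡⟨ cong (λ t → (x - + 1) * ((x - + 0) * (t * ((x - top) * + 1)))) (prodRoots-suc S x) ⟩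
    (x - + 1) * ((x - + 0) * (prodRoots S (x - + 1) * ((x - top) * + 1)))
      ≡⟨ ring x top (prodRoots S (x - + 1)) ⟩
    x * ((x - + 1) * ((x - top) * prodRoots S (x - + 1))) ∎
    where
    top = + (3 ℕ.+ length S)
    ring : ∀ x t P → (x - + 1) * ((x - + 0) * (P * ((x - t) * + 1))) ≡ x * ((x - + 1) * ((x - t) * P))
    ring = solve-∀

  realizable-apexJoin : ∀ S → LaplacianRealizable S → LaplacianRealizable (apexJoinSpectrum S)
  realizable-apexJoin S (G , connected , spectrum) =
    subst (λ k → Σ (SimpleGraph k) λ H → Connected H × LaplacianSpectrumIs H (apexJoinSpectrum S))
          (sym length-apexJoinSpectrum)
          (apexJoin G , apexJoin-connected G , apexJoin-spectrum)
    where
    length-apexJoinSpectrum : length (apexJoinSpectrum S) ≡ 3 ℕ.+ length S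
    length-apexJoinSpectrum = cong (2 ℕ.+_) (begin
      length (map ℤ.suc S ++ + (3 ℕ.+ length S) ∷ []) ≡⟨ length-++ (map ℤ.suc S) ⟩
      length (map ℤ.suc S) ℕ.+ 1                      ≡⟨ cong (ℕ._+ 1) (length-map ℤ.suc S) ⟩
      length S ℕ.+ 1                                  ≡⟨ ℕ.+-comm (length S) 1 ⟩
      suc (length S)                                  ∎)
    apexJoin-spectrum : LaplacianSpectrumIs (apexJoin G) (apexJoinSpectrum S)
    apexJoin-spectrum x = begin
      charPolyAt (apexJoin G) x
        ≡⟨ charPoly-apexJoin G x ⟩
      x * ((x - + 1) * ((x - + (3 ℕ.+ length S)) * charPolyAt G (x - + 1)))
        ≡⟨ cong (λ t → x * ((x - + 1) * ((x - + (3 ℕ.+ length S)) * t))) (spectrum (x - + 1)) ⟩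
      x * ((x - + 1) * ((x - + (3 ℕ.+ length S)) * prodRoots S (x - + 1)))
        ≡⟨ prodRoots-apexJoinSpectrum S x ⟨
      prodRoots (apexJoinSpectrum S) x ∎

open LaplacianSpectrum using (apexJoinSpectrum; realizable-apexJoin)
open import Data.Integer using (+_)
open import Data.Nat using (_+_; _≤_; _≤′_; ≤′-refl; ≤′-step)

filter-map : ∀ {A B : Set} {P : Pred B 0ℓ} (P? : Decidable P) (f : A → B) xs →
             filter P? (map f xs) ≡ map f (filter (P? ∘ f) xs)
filter-map P? f []       = refl
filter-map P? f (x ∷ xs) with does (P? (f x))
... | true  = cong (f x ∷_) (filter-map P? f xs)
... | false = filter-map P? f xs

filter-cong-All : ∀ {A : Set} {P Q : Pred A 0ℓ} (P? : Decidable P) (Q? : Decidable Q) {xs} →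
                  All (λ x → (P x → Q x) × (Q x → P x)) xs → filter P? xs ≡ filter Q? xs
filter-cong-All P? Q? []                       = refl
filter-cong-All P? Q? {x ∷ _} ((P⇒Q , Q⇒P) ∷ rest) with Q? x
... | yes qx = trans (filter-accept P? (Q⇒P qx)) (cong (x ∷_) (filter-cong-All P? Q? rest))
... | no ¬qx = trans (filter-reject P? (¬qx ∘ P⇒Q)) (filter-cong-All P? Q? rest)

filter-upTo-suc : ∀ {P : Pred ℕ 0ℓ} (P? : Decidable P) m →
                  filter P? (upTo (suc m)) ≡ filter P? (upTo m) ++ filter P? (m ∷ [])
filter-upTo-suc P? m = trans (cong (filter P?) (sym (upTo-∷ʳ m))) (filter-++ P? (upTo m) (m ∷ []))

without : ℕ → ℕ → List ℕ
without i n = filter (λ k → ¬? (k ℕ.≟ i)) (upTo (suc n))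

length-without : ∀ {i n} → i ≤′ n → length (without i n) ≡ n
length-without {i} ≤′-refl = begin
  length (without i i)                                  ≡⟨ cong length (filter-upTo-suc ≢i? i) ⟩
  length (filter ≢i? (upTo i) ++ filter ≢i? (i ∷ []))   ≡⟨ cong₂ (λ xs ys → length (xs ++ ys)) kept dropped ⟩
  length (upTo i ++ [])                                 ≡⟨ cong length (++-identityʳ (upTo i)) ⟩
  length (upTo i)                                       ≡⟨ length-upTo i ⟩
  i                                                     ∎
  where
  open ≡-Reasoning
  ≢i? = λ k → ¬? (k ℕ.≟ i)
  kept : filter ≢i? (upTo i) ≡ upTo i
  kept = filter-all ≢i? (All.tabulate λ k∈ → ℕ.<⇒≢ (∈-upTo⁻ k∈))
  dropped : filter ≢i? (i ∷ []) ≡ []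
  dropped = filter-reject ≢i? (λ i≢i → i≢i refl)
length-without {i} {suc n} (≤′-step i≤′n) = begin
  length (without i (suc n))                            ≡⟨ cong length (filter-upTo-suc ≢i? (suc n)) ⟩
  length (without i n ++ filter ≢i? (suc n ∷ []))       ≡⟨ cong (λ ys → length (without i n ++ ys)) kept ⟩
  length (without i n ++ suc n ∷ [])                    ≡⟨ length-++ (without i n) ⟩
  length (without i n) + 1                              ≡⟨ cong (_+ 1) (length-without i≤′n) ⟩
  n + 1                                                 ≡⟨ ℕ.+-comm n 1 ⟩
  suc n                                                 ∎
  where
  open ≡-Reasoning
  ≢i? = λ k → ¬? (k ℕ.≟ i)
  kept : filter ≢i? (suc n ∷ []) ≡ suc n ∷ []
  kept = filter-accept ≢i? (ℕ.<⇒≢ (ℕ.s≤s (ℕ.≤′⇒≤ i≤′n)) ∘ sym)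

filter-pair-upTo : ∀ {i n} → i ≤ n →
                   filter (λ k → ¬? (k ℕ.≟ suc i) ×-dec ¬? (k ℕ.≟ 2 + n)) (upTo (4 + n))
                   ≡ 0 ∷ map suc (without i n) ++ 3 + n ∷ []
filter-pair-upTo {i} {n} i≤n = begin
  filter P? (upTo (4 + n))                       ≡⟨ cong (λ xs → filter P? (0 ∷ xs)) (map-upTo suc (3 + n)) ⟨
  0 ∷ filter P? (map suc (upTo (3 + n)))         ≡⟨ cong (0 ∷_) (filter-map P? suc (upTo (3 + n))) ⟩
  0 ∷ map suc (filter Q? (upTo (3 + n)))         ≡⟨ cong (λ xs → 0 ∷ map suc xs) shifted ⟩
  0 ∷ map suc (without i n ++ 2 + n ∷ [])        ≡⟨ cong (0 ∷_) (map-++ suc (without i n) _) ⟩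
  0 ∷ map suc (without i n) ++ 3 + n ∷ []        ∎
  where
  open ≡-Reasoning
  P? = λ k → ¬? (k ℕ.≟ suc i) ×-dec ¬? (k ℕ.≟ 2 + n)
  Q : Pred ℕ 0ℓ
  Q k = suc k ≢ suc i × suc k ≢ 2 + n
  Q? : Decidable Q
  Q? = P? ∘ suc
  agree : All (λ k → (Q k → k ≢ i) × (k ≢ i → Q k)) (upTo (suc n))
  agree = All.tabulate λ k∈ →
    (λ (sk≢si , _) k≡i → sk≢si (cong suc k≡i)) ,
    (λ k≢i → k≢i ∘ ℕ.suc-injective , ℕ.<⇒≢ (∈-upTo⁻ k∈) ∘ ℕ.suc-injective)
  top-kept : Q (2 + n)
  top-kept = ℕ.<⇒≢ (ℕ.s≤s (ℕ.m≤n⇒m≤1+n i≤n)) ∘ sym ∘ ℕ.suc-injective , ℕ.1+n≢n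
  shifted : filter Q? (upTo (3 + n)) ≡ without i n ++ 2 + n ∷ []
  shifted = begin
    filter Q? (upTo (3 + n))
      ≡⟨ filter-upTo-suc Q? (2 + n) ⟩
    filter Q? (upTo (2 + n)) ++ filter Q? (2 + n ∷ [])
      ≡⟨ cong (_++ filter Q? (2 + n ∷ [])) (filter-upTo-suc Q? (suc n)) ⟩
    (filter Q? (upTo (suc n)) ++ filter Q? (suc n ∷ [])) ++ filter Q? (2 + n ∷ [])
      ≡⟨ cong₂ _++_ (cong₂ _++_ (filter-cong-All Q? (λ k → ¬? (k ℕ.≟ i)) agree)
                                (filter-reject Q? λ (_ , ne) → ne refl))
                    (filter-accept Q? top-kept) ⟩
    (without i n ++ []) ++ 2 + n ∷ []
      ≡⟨ cong (_++ 2 + n ∷ []) (++-identityʳ (without i n)) ⟩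
    without i n ++ 2 + n ∷ [] ∎

S-pair≡apexJoinSpectrum : ∀ {i n} → i ≤ n →
                          S-pair (suc i) (2 + n) (3 + n) 1 ≡ apexJoinSpectrum (S-single i n)
S-pair≡apexJoinSpectrum {i} {n} i≤n = cong (+ 1 ∷_) (begin
  map ℤ+ (filter (λ k → ¬? (k ℕ.≟ suc i) ×-dec ¬? (k ℕ.≟ 2 + n)) (upTo (4 + n)))
    ≡⟨ cong (map ℤ+) (filter-pair-upTo i≤n) ⟩
  map ℤ+ (0 ∷ map suc (without i n) ++ 3 + n ∷ [])
    ≡⟨ cong (+ 0 ∷_) (map-++ ℤ+ (map suc (without i n)) _) ⟩
  + 0 ∷ map ℤ+ (map suc (without i n)) ++ + (3 + n) ∷ []
    ≡⟨ cong₂ (λ xs m → + 0 ∷ xs ++ + (3 + m) ∷ [])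
             (trans (sym (map-∘ (without i n))) (map-∘ (without i n)))
             (sym (trans (length-map ℤ+ (without i n)) (length-without (ℕ.≤⇒≤′ i≤n)))) ⟩
  + 0 ∷ map ℤ.suc (S-single i n) ++ + (3 + length (S-single i n)) ∷ [] ∎)
  where
  open ≡-Reasoning
  -- Written out because map +_ would also parse as a section of ℕ's _+_.
  ℤ+ = λ (k : ℕ) → + k

lemma3p1 : (n i : ℕ) → 1 ≤ n → 1 ≤ i → i ≤ n →
    LaplacianRealizable (S-single i n) →
    LaplacianRealizable (S-pair (i + 1) (n + 2) (n + 3) 1)
lemma3p1 n i _ _ i≤n realizable rewrite ℕ.+-comm i 1 | ℕ.+-comm n 2 | ℕ.+-comm n 3 =
  subst LaplacianRealizable (sym (S-pair≡apexJoinSpectrum i≤n)) (realizable-apexJoin (S-single i n) realizable)
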